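{- Let $u,v\in X^*$ be words, $I\subseteq[1\dots|u|]$ and $J\subseteq[|u|+1\dots|u|+|v|]$. Then $$pack\big((u*v)[I\cup J]\big)=pack(u[I])*pack(v[J']),$$ where $J'=\{j-|u|: j\in J\}$.
   Context: $X=\{x_i\}_{i\ge 0}$ is an alphabet totally ordered by index, $X^*$ the free monoid of words over $X$. For a word $w$, $|w|$ is its length, $w[i]$ its $i$-th letter, $IAlph(w)=\{i\in\mathbb N: x_i\text{ occurs in }w\}$, and $sup(w)$ is the supremum of $IAlph(w)$ in $\mathbb N$ (with $sup$ of the empty word equal to $0$). For $\phi$ on $IAlph(w)$ with values in $\mathbb N$ and $\phi(0)=0$, $S_\phi(x_{i_1}\cdots x_{i_m})=x_{\phi(i_1)}\cdots x_{\phi(i_m)}$. If $IAlph(w)\setminus\{0\}=\{j_1<\dots<j_k\}$, let $\phi_w(j_m)=m$, $\phi_w(0)=0$ and $pack(w)=S_{\phi_w}(w)$. For $t\in\mathbb N$, $T_t(w)=S_\phi(w)$ with $\phi(n)=n+t$ for $n>0$, $\phi(0)=0$. The shifted concatenation is $u*v=u\,T_{sup(u)}(v)$. For $I=\{i_1<\dots<i_l\}\subseteq[1\dots|w|]$, the subword is $w[I]=w[i_1]\cdots w[i_l]$. -}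

module Defs where

open import Data.Nat using (ℕ; zero; suc; _+_; _⊔_; _≡ᵇ_; _≤_)
open import Data.Bool using (Bool; true; false; if_then_else_; _∨_)
open import Data.List using (List; []; _∷_; map; foldr; length; filterᵇ; _++_)
open import Data.List.Base using (upTo)
open import Data.Bool.ListAction using (any)
open import Relation.Binary.PropositionalEquality using (_≡_)

-- A word over X = {x_i} is a list of indices: the letter x_i is the number i.
Word : Set
Word = List ℕ

sup : Word → ℕ
sup = foldr _⊔_ 0

occurs : ℕ → Word → Bool
occurs j w = any (λ a → a ≡ᵇ j) w

S : (ℕ → ℕ) → Word → Word
S φ = map φ

shiftφ : ℕ → ℕ → ℕ
shiftφ t zero = zero
shiftφ t (suc n) = suc n + t

T : ℕ → Word → Word
T t = S (shiftφ t)

infixr 6 _⋆_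
_⋆_ : Word → Word → Word
u ⋆ v = u ++ T (sup u) v

-- φ_w(j) = #{ m ∈ IAlph(w) \ {0} : m ≤ j }, so φ_w(j_m) = m; φ_w(0) = 0
φpack : Word → ℕ → ℕ
φpack w zero = zero
φpack w (suc n) = length (filterᵇ (λ m → occurs (suc m) w) (upTo (suc n)))

pack : Word → Word
pack w = S (φpack w) w

-- subsets of positions given by characteristic functions ℕ → Bool (positions are 1-based)
Subset : Set
Subset = ℕ → Bool

_∈ˢ_ : ℕ → Subset → Set
i ∈ˢ I = I i ≡ true

-- w[I]: letters of w at positions in I, in increasing order; position of head is k
subwordFrom : ℕ → Subset → Word → Word
subwordFrom k I [] = []
subwordFrom k I (a ∷ w) = if I k then a ∷ subwordFrom (suc k) I w else subwordFrom (suc k) I w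

infixl 20 _[_]
_[_] : Word → Subset → Word
w [ I ] = subwordFrom 1 I w

_∪ˢ_ : Subset → Subset → Subset
(I ∪ˢ J) i = I i ∨ J i

-- J' = { j - n : j ∈ J } for J ⊆ [n+1 ...]: j ∈ J' iff j + n ∈ J  (j ≥ 1)
shiftDown : ℕ → Subset → Subset
shiftDown n J j = J (j + n)

module Submission where

-- The packing map φ_w is a rank function: φ_w(n) counts the letters
-- x_{m+1}, m < n, occurring in w.  We first develop a small theory of such
-- counts ('count'), then prove the central fact 'pack-shifted-concat':
-- if every letter of a is at most s, then
--     pack (a T_s(b)) = pack a * pack b.
-- Indeed, below s the alphabet of a T_s(b) agrees with that of a, so φ acts on
-- the a-part as φ_a; above s it is the alphabet of b shifted by s, so φ acts
-- on the T_s(b)-part as φ_b shifted by the number of distinct nonzero letters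
-- of a, which is exactly sup (pack a).
-- Independently, a subword of a concatenation splits along the concatenation
-- when I lives on the first factor and J on the second ('subword-union'), and
-- taking subwords commutes with letterwise substitution.  The theorem follows
-- by applying 'pack-shifted-concat' with a = u[I], b = v[J'] and s = sup u.

open import Defs
open import Data.Nat using (ℕ; _+_; _≤_)
open import Data.List using (length)
open import Data.Product using (_×_)
open import Relation.Binary.PropositionalEquality using (_≡_)

open import Data.Nat using (zero; suc; _<_; _⊔_; _≡ᵇ_; _∸_; z≤n; s≤s)
open import Data.Nat.Properties
open import Data.Bool using (Bool; true; false; _∨_; if_then_else_)
open import Data.Bool.Properties using (∨-identityʳ; ∨-zeroʳ; ∨-assoc; ¬-not; T-≡)
open import Data.List using ([]; _∷_; map; filterᵇ; _++_)
open import Data.List.Base using (upTo)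
open import Data.List.Properties using (upTo-∷ʳ; map-++; map-∘; filter-++; length-++)
open import Data.Product using (proj₁; proj₂)
open import Data.Empty using (⊥-elim)
open import Function using (_∘_)
open import Function.Bundles using (Equivalence)
open import Relation.Nullary.Decidable using (T?)
open import Relation.Binary.PropositionalEquality
  using (_≢_; refl; sym; trans; cong; cong₂; subst; subst₂; module ≡-Reasoning)

≡ᵇ-refl : ∀ n → (n ≡ᵇ n) ≡ true
≡ᵇ-refl zero    = refl
≡ᵇ-refl (suc n) = ≡ᵇ-refl n

≡ᵇ-sound : ∀ m n → (m ≡ᵇ n) ≡ true → m ≡ n
≡ᵇ-sound m n e = ≡ᵇ⇒≡ m n (Equivalence.from T-≡ e)

≡ᵇ-false : ∀ m n → m ≢ n → (m ≡ᵇ n) ≡ false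
≡ᵇ-false m n m≢n with m ≡ᵇ n in e
... | true  = ⊥-elim (m≢n (≡ᵇ-sound m n e))
... | false = refl

≡ᵇ-false⇒≢ : ∀ m n → (m ≡ᵇ n) ≡ false → m ≢ n
≡ᵇ-false⇒≢ m .m e refl with () ← trans (sym (≡ᵇ-refl m)) e

≡ᵇ-injective : (f : ℕ → ℕ) → (∀ {x y} → f x ≡ f y → x ≡ y) →
               ∀ x y → (f x ≡ᵇ f y) ≡ (x ≡ᵇ y)
≡ᵇ-injective f inj x y with x ≡ᵇ y in e
... | true rewrite ≡ᵇ-sound x y e = ≡ᵇ-refl (f y)
... | false = ≡ᵇ-false (f x) (f y) (≡ᵇ-false⇒≢ x y e ∘ inj)

occurs-here : ∀ x l → occurs x (x ∷ l) ≡ true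
occurs-here x l = cong (_∨ occurs x l) (≡ᵇ-refl x)

occurs-there : ∀ x {y} l → occurs y l ≡ true → occurs y (x ∷ l) ≡ true
occurs-there x {y} l o = trans (cong ((x ≡ᵇ y) ∨_) o) (∨-zeroʳ (x ≡ᵇ y))

occurs-++ : ∀ j a c → occurs j (a ++ c) ≡ (occurs j a ∨ occurs j c)
occurs-++ j []      c = refl
occurs-++ j (x ∷ a) c =
  trans (cong ((x ≡ᵇ j) ∨_) (occurs-++ j a c)) (sym (∨-assoc (x ≡ᵇ j) (occurs j a) (occurs j c)))

occurs-map-injective : (f : ℕ → ℕ) → (∀ {x y} → f x ≡ f y → x ≡ y) →
                       ∀ j b → occurs (f j) (map f b) ≡ occurs j b
occurs-map-injective f inj j []      = refl
occurs-map-injective f inj j (x ∷ b) =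
  cong₂ _∨_ (≡ᵇ-injective f inj x j) (occurs-map-injective f inj j b)

occurs-map-outside : (f : ℕ → ℕ) → ∀ j → (∀ x → f x ≢ j) → ∀ b → occurs j (map f b) ≡ false
occurs-map-outside f j ∉im []      = refl
occurs-map-outside f j ∉im (x ∷ b) =
  cong₂ _∨_ (≡ᵇ-false (f x) j (∉im x)) (occurs-map-outside f j ∉im b)

map-cong-occurs : (f g : ℕ → ℕ) → ∀ l → (∀ x → occurs x l ≡ true → f x ≡ g x) → map f l ≡ map g l
map-cong-occurs f g []      agree = refl
map-cong-occurs f g (x ∷ l) agree =
  cong₂ _∷_ (agree x (occurs-here x l))
            (map-cong-occurs f g l (λ y o → agree y (occurs-there x l o)))

Bounded : ℕ → Word → Set
Bounded s w = ∀ x → occurs x w ≡ true → x ≤ s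

bounded-∷ : ∀ {s y} l → y ≤ s → Bounded s l → Bounded s (y ∷ l)
bounded-∷ {y = y} l y≤s bnd x o with y ≡ᵇ x in e
... | true  = subst (_≤ _) (≡ᵇ-sound y x e) y≤s
... | false = bnd x o

bounded-tail : ∀ {s} y l → Bounded s (y ∷ l) → Bounded s l
bounded-tail y l bnd x o = bnd x (occurs-there y l o)

sup-bound : ∀ w → Bounded (sup w) w
sup-bound []      y ()
sup-bound (x ∷ w) = bounded-∷ w (m≤m⊔n x (sup w)) (λ y o → m≤n⇒m≤o⊔n x (sup-bound w y o))

sup-least : ∀ {s} w → Bounded s w → sup w ≤ s
sup-least []      bnd = z≤n
sup-least (x ∷ w) bnd =
  ⊔-lub (bnd x (occurs-here x w)) (sup-least w (bounded-tail x w bnd))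

occurs-above : ∀ {s j} w → Bounded s w → s < j → occurs j w ≡ false
occurs-above {j = j} w bnd s<j with occurs j w in e
... | true  = ⊥-elim (<⇒≱ s<j (bnd j e))
... | false = refl

sup-map-monotone : (f : ℕ → ℕ) → f 0 ≡ 0 → (∀ {m n} → m ≤ n → f m ≤ f n) →
                   ∀ l → sup (map f l) ≡ f (sup l)
sup-map-monotone f f0 mono []      = sym f0
sup-map-monotone f f0 mono (x ∷ l) =
  trans (cong (f x ⊔_) (sup-map-monotone f f0 mono l)) (sym (mono-≤-distrib-⊔ mono x (sup l)))

indicator : Bool → ℕ
indicator true  = 1
indicator false = 0

count : (ℕ → Bool) → ℕ → ℕ
count P zero    = 0
count P (suc n) = count P n + indicator (P n)

length-filter-singleton : ∀ (P : ℕ → Bool) n → length (filterᵇ P (n ∷ [])) ≡ indicator (P n)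
length-filter-singleton P n with P n
... | true  = refl
... | false = refl

length-filter-upTo : ∀ P n → length (filterᵇ P (upTo n)) ≡ count P n
length-filter-upTo P zero    = refl
length-filter-upTo P (suc n) = begin
    length (filterᵇ P (upTo (suc n)))
  ≡⟨ cong (length ∘ filterᵇ P) (sym (upTo-∷ʳ n)) ⟩
    length (filterᵇ P (upTo n ++ n ∷ []))
  ≡⟨ cong length (filter-++ (T? ∘ P) (upTo n) (n ∷ [])) ⟩
    length (filterᵇ P (upTo n) ++ filterᵇ P (n ∷ []))
  ≡⟨ length-++ (filterᵇ P (upTo n)) ⟩
    length (filterᵇ P (upTo n)) + length (filterᵇ P (n ∷ []))
  ≡⟨ cong₂ _+_ (length-filter-upTo P n) (length-filter-singleton P n) ⟩
    count P n + indicator (P n) ∎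
  where open ≡-Reasoning

count-cong : ∀ P Q n → (∀ m → m < n → P m ≡ Q m) → count P n ≡ count Q n
count-cong P Q zero    agree = refl
count-cong P Q (suc n) agree =
  cong₂ _+_ (count-cong P Q n (λ m m<n → agree m (m<n⇒m<1+n m<n))) (cong indicator (agree n ≤-refl))

count-split : ∀ P s n → count P (s + n) ≡ count P s + count (P ∘ (s +_)) n
count-split P s zero    = trans (cong (count P) (+-identityʳ s)) (sym (+-identityʳ _))
count-split P s (suc n) = begin
    count P (s + suc n)
  ≡⟨ cong (count P) (+-suc s n) ⟩
    count P (s + n) + indicator (P (s + n))
  ≡⟨ cong (_+ indicator (P (s + n))) (count-split P s n) ⟩
    count P s + count (P ∘ (s +_)) n + indicator (P (s + n))
  ≡⟨ +-assoc (count P s) _ _ ⟩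
    count P s + count (P ∘ (s +_)) (suc n) ∎
  where open ≡-Reasoning

count-false : ∀ P n → (∀ m → P m ≡ false) → count P n ≡ 0
count-false P zero    none = refl
count-false P (suc n) none = cong₂ _+_ (count-false P n none) (cong indicator (none n))

count-mono : ∀ P {m n} → m ≤ n → count P m ≤ count P n
count-mono P {m} {n} m≤n = subst (λ k → count P m ≤ count P k) (m+[n∸m]≡n m≤n)
  (subst (count P m ≤_) (sym (count-split P m (n ∸ m))) (m≤m+n _ _))

count-stable : ∀ P {t s} → (∀ i → P (t + i) ≡ false) → t ≤ s → count P s ≡ count P t
count-stable P {t} {s} none t≤s = begin
    count P s
  ≡⟨ cong (count P) (sym (m+[n∸m]≡n t≤s)) ⟩
    count P (t + (s ∸ t))
  ≡⟨ count-split P t (s ∸ t) ⟩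
    count P t + count (P ∘ (t +_)) (s ∸ t)
  ≡⟨ cong (count P t +_) (count-false _ (s ∸ t) none) ⟩
    count P t + 0
  ≡⟨ +-identityʳ _ ⟩
    count P t ∎
  where open ≡-Reasoning

Occ : Word → ℕ → Bool
Occ w m = occurs (suc m) w

φpack-count : ∀ w n → φpack w n ≡ count (Occ w) n
φpack-count w zero    = refl
φpack-count w (suc n) = length-filter-upTo (Occ w) (suc n)

φpack-mono : ∀ w {m n} → m ≤ n → φpack w m ≤ φpack w n
φpack-mono w {m} {n} m≤n =
  subst₂ _≤_ (sym (φpack-count w m)) (sym (φpack-count w n)) (count-mono (Occ w) m≤n)

count-occurring : ∀ w n → occurs (suc n) w ≡ true → count (Occ w) (suc n) ≡ suc (count (Occ w) n)
count-occurring w n o = trans (cong (λ b → count (Occ w) n + indicator b) o) (+-comm _ 1)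

sup-pack : ∀ {s} w → Bounded s w → sup (pack w) ≡ count (Occ w) s
sup-pack {s} w bnd = begin
    sup (map (φpack w) w)
  ≡⟨ sup-map-monotone (φpack w) refl (φpack-mono w) w ⟩
    φpack w (sup w)
  ≡⟨ φpack-count w (sup w) ⟩
    count (Occ w) (sup w)
  ≡⟨ sym (count-stable (Occ w) beyond-sup (sup-least w bnd)) ⟩
    count (Occ w) s ∎
  where
  open ≡-Reasoning
  beyond-sup : ∀ i → Occ w (sup w + i) ≡ false
  beyond-sup i = occurs-above w (sup-bound w) (s≤s (m≤m+n (sup w) i))

shiftφ-injective : ∀ s {x y} → shiftφ s x ≡ shiftφ s y → x ≡ y
shiftφ-injective s {zero}  {zero}  eq = refl
shiftφ-injective s {suc x} {suc y} eq = cong suc (+-cancelʳ-≡ s x y (suc-injective eq))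

shiftφ-avoids : ∀ s {m} → m < s → ∀ x → shiftφ s x ≢ suc m
shiftφ-avoids s m<s zero    ()
shiftφ-avoids s m<s (suc n) eq = <⇒≱ m<s (subst (s ≤_) (suc-injective eq) (m≤n+m s n))

module ShiftedConcat (a b : Word) (s : ℕ) (a≤s : Bounded s a) where

  w : Word
  w = a ++ T s b

  c : ℕ
  c = count (Occ a) s

  Occ-low : ∀ m → m < s → Occ w m ≡ Occ a m
  Occ-low m m<s = begin
      occurs (suc m) (a ++ T s b)
    ≡⟨ occurs-++ (suc m) a (T s b) ⟩
      Occ a m ∨ occurs (suc m) (T s b)
    ≡⟨ cong (Occ a m ∨_) (occurs-map-outside (shiftφ s) (suc m) (shiftφ-avoids s m<s) b) ⟩
      Occ a m ∨ false
    ≡⟨ ∨-identityʳ (Occ a m) ⟩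
      Occ a m ∎
    where open ≡-Reasoning

  Occ-high : ∀ i → Occ w (s + i) ≡ Occ b i
  Occ-high i = begin
      occurs (suc (s + i)) (a ++ T s b)
    ≡⟨ occurs-++ (suc (s + i)) a (T s b) ⟩
      occurs (suc (s + i)) a ∨ occurs (suc (s + i)) (T s b)
    ≡⟨ cong₂ _∨_ (occurs-above a a≤s (s≤s (m≤m+n s i))) (cong (λ k → occurs (suc k) (T s b)) (+-comm s i)) ⟩
      occurs (shiftφ s (suc i)) (T s b)
    ≡⟨ occurs-map-injective (shiftφ s) (shiftφ-injective s) (suc i) b ⟩
      Occ b i ∎
    where open ≡-Reasoning

  count-low : ∀ x → x ≤ s → count (Occ w) x ≡ count (Occ a) x
  count-low x x≤s = count-cong _ _ x (λ m m<x → Occ-low m (<-≤-trans m<x x≤s))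

  count-high : ∀ n → count (Occ w) (s + n) ≡ c + count (Occ b) n
  count-high n = trans (count-split (Occ w) s n)
    (cong₂ _+_ (count-low s ≤-refl) (count-cong _ _ n (λ i _ → Occ-high i)))

  pack-low : map (φpack w) a ≡ pack a
  pack-low = map-cong-occurs _ _ a λ x o → begin
      φpack w x           ≡⟨ φpack-count w x ⟩
      count (Occ w) x     ≡⟨ count-low x (a≤s x o) ⟩
      count (Occ a) x     ≡⟨ sym (φpack-count a x) ⟩
      φpack a x           ∎
    where open ≡-Reasoning

  pack-high : map (φpack w) (T s b) ≡ T c (pack b)
  pack-high = trans (sym (map-∘ b)) (trans (map-cong-occurs _ _ b φ-shift) (map-∘ b))
    where
    open ≡-Reasoning
    φ-shift : ∀ y → occurs y b ≡ true → φpack w (shiftφ s y) ≡ shiftφ c (φpack b y)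
    φ-shift zero    _ = refl
    φ-shift (suc n) o = begin
        φpack w (suc n + s)
      ≡⟨ φpack-count w (suc n + s) ⟩
        count (Occ w) (suc n + s)
      ≡⟨ cong (count (Occ w)) (+-comm (suc n) s) ⟩
        count (Occ w) (s + suc n)
      ≡⟨ count-high (suc n) ⟩
        c + count (Occ b) (suc n)
      ≡⟨ cong (c +_) (count-occurring b n o) ⟩
        c + suc (count (Occ b) n)
      ≡⟨ +-comm c _ ⟩
        shiftφ c (suc (count (Occ b) n))
      ≡⟨ cong (shiftφ c) (sym (count-occurring b n o)) ⟩
        shiftφ c (count (Occ b) (suc n))
      ≡⟨ cong (shiftφ c) (sym (φpack-count b (suc n))) ⟩
        shiftφ c (φpack b (suc n)) ∎

  pack-shifted-concat : pack w ≡ pack a ⋆ pack b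
  pack-shifted-concat = begin
      map (φpack w) (a ++ T s b)
    ≡⟨ map-++ (φpack w) a (T s b) ⟩
      map (φpack w) a ++ map (φpack w) (T s b)
    ≡⟨ cong₂ _++_ pack-low pack-high ⟩
      pack a ++ T c (pack b)
    ≡⟨ cong (λ t → pack a ++ T t (pack b)) (sym (sup-pack a a≤s)) ⟩
      pack a ⋆ pack b ∎
    where open ≡-Reasoning

open ShiftedConcat using (pack-shifted-concat)

subword-++ : ∀ k I a c → subwordFrom k I (a ++ c) ≡ subwordFrom k I a ++ subwordFrom (k + length a) I c
subword-++ k I []      c = cong (λ m → subwordFrom m I c) (sym (+-identityʳ k))
subword-++ k I (x ∷ a) c
  with I k | trans (subword-++ (suc k) I a c)
                   (cong (λ m → subwordFrom (suc k) I a ++ subwordFrom m I c) (sym (+-suc k (length a))))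
... | true  | rest = cong (x ∷_) rest
... | false | rest = rest

subword-cong : ∀ k (I I′ : Subset) a → (∀ i → k ≤ i → i < k + length a → I i ≡ I′ i) →
               subwordFrom k I a ≡ subwordFrom k I′ a
subword-cong k I I′ []      agree = refl
subword-cong k I I′ (x ∷ a) agree =
  cong₂ (λ b r → if b then x ∷ r else r) (agree k ≤-refl k<end) (subword-cong (suc k) I I′ a agree′)
  where
  k<end : k < k + suc (length a)
  k<end = m<m+n k (s≤s z≤n)
  agree′ : ∀ i → suc k ≤ i → i < suc k + length a → I i ≡ I′ i
  agree′ i k<i i<end = agree i (<⇒≤ k<i) (subst (i <_) (sym (+-suc k (length a))) i<end)

subword-map : ∀ k I (f : ℕ → ℕ) l → subwordFrom k I (map f l) ≡ map f (subwordFrom k I l)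
subword-map k I f []      = refl
subword-map k I f (x ∷ l) with I k
... | true  = cong (f x ∷_) (subword-map (suc k) I f l)
... | false = subword-map (suc k) I f l

subword-shiftDown : ∀ k n J l → subwordFrom k (shiftDown n J) l ≡ subwordFrom (k + n) J l
subword-shiftDown k n J []      = refl
subword-shiftDown k n J (x ∷ l) with J (k + n)
... | true  = cong (x ∷_) (subword-shiftDown (suc k) n J l)
... | false = subword-shiftDown (suc k) n J l

subword-bounded : ∀ {s} k I l → Bounded s l → Bounded s (subwordFrom k I l)
subword-bounded k I []      bnd = bnd
subword-bounded k I (y ∷ l) bnd with I k
... | true  = bounded-∷ (subwordFrom (suc k) I l) (bnd y (occurs-here y l)) (subword-bounded (suc k) I l (bounded-tail y l bnd))
... | false = subword-bounded (suc k) I l (bounded-tail y l bnd)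

subword-union : ∀ k (I J : Subset) a c →
                (∀ i → i ∈ˢ I → i < k + length a) → (∀ j → j ∈ˢ J → k + length a ≤ j) →
                subwordFrom k (I ∪ˢ J) (a ++ c) ≡ subwordFrom k I a ++ subwordFrom (k + length a) J c
subword-union k I J a c I-left J-right = begin
    subwordFrom k (I ∪ˢ J) (a ++ c)
  ≡⟨ subword-++ k (I ∪ˢ J) a c ⟩
    subwordFrom k (I ∪ˢ J) a ++ subwordFrom (k + length a) (I ∪ˢ J) c
  ≡⟨ cong₂ _++_ (subword-cong k _ _ a on-a) (subword-cong (k + length a) _ _ c on-c) ⟩
    subwordFrom k I a ++ subwordFrom (k + length a) J c ∎
  where
  open ≡-Reasoning
  on-a : ∀ i → k ≤ i → i < k + length a → (I ∪ˢ J) i ≡ I i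
  on-a i _ i<end = trans (cong (I i ∨_) (¬-not λ j∈J → <⇒≱ i<end (J-right i j∈J))) (∨-identityʳ (I i))
  on-c : ∀ i → k + length a ≤ i → i < k + length a + length c → (I ∪ˢ J) i ≡ J i
  on-c i end≤i _ = cong (_∨ J i) (¬-not λ i∈I → <⇒≱ (I-left i i∈I) end≤i)

mainTheorem6 : (u v : Word) (I J : Subset)
    → (∀ i → i ∈ˢ I → 1 ≤ i × i ≤ length u)
    → (∀ j → j ∈ˢ J → length u + 1 ≤ j × j ≤ length u + length v)
    → pack ((u ⋆ v) [ I ∪ˢ J ]) ≡ pack (u [ I ]) ⋆ pack (v [ shiftDown (length u) J ])
mainTheorem6 u v I J I⊆u J⊆v = begin
    pack (subwordFrom 1 (I ∪ˢ J) (u ++ T (sup u) v))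
  ≡⟨ cong pack (subword-union 1 I J u (T (sup u) v) I-left J-right) ⟩
    pack (u [ I ] ++ subwordFrom (1 + length u) J (T (sup u) v))
  ≡⟨ cong (λ r → pack (u [ I ] ++ r)) (subword-map (1 + length u) J (shiftφ (sup u)) v) ⟩
    pack (u [ I ] ++ T (sup u) (subwordFrom (1 + length u) J v))
  ≡⟨ cong (λ r → pack (u [ I ] ++ T (sup u) r)) (sym (subword-shiftDown 1 (length u) J v)) ⟩
    pack (u [ I ] ++ T (sup u) (v [ J′ ]))
  ≡⟨ pack-shifted-concat (u [ I ]) (v [ J′ ]) (sup u) (subword-bounded 1 I u (sup-bound u)) ⟩
    pack (u [ I ]) ⋆ pack (v [ J′ ]) ∎
  where
  open ≡-Reasoning
  J′ : Subset
  J′ = shiftDown (length u) J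
  I-left : ∀ i → i ∈ˢ I → i < 1 + length u
  I-left i i∈I = s≤s (proj₂ (I⊆u i i∈I))
  J-right : ∀ j → j ∈ˢ J → 1 + length u ≤ j
  J-right j j∈J = subst (_≤ j) (+-comm (length u) 1) (proj₁ (J⊆v j j∈J))
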